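{- Let $E$ be a propositional variable, $s$ an agent, and $c$ a justification constant. Let $\mathcal{F}=\{c:_s(E\wedge\neg(\exists x)x:_sE\rightarrow E)\}$. Then $\mathsf{QLP}^-_{\mathcal{F}}\vdash\neg(\exists y)y:_s[E\wedge\neg(\exists x)x:_sE]$ (in the multi-agent version of $\mathsf{QLP}^-$).
   Context: Let $\mathcal{A}=\{1,\dots,n\}$ be a set of agents. Fix countably many justification variables, propositional variables, and primitive function symbols of each arity $k\ge0$ (arity $0$: justification constants); a primitive term is $f(x_1,\dots,x_k)$ with $x_i$ variables. Terms: $t::= x\mid f(x_1,\dots,x_k)\mid t\cdot t\mid t+t\mid !t$. Formulas: $A::= p\mid\bot\mid\neg A\mid A\wedge A\mid A\vee A\mid A\rightarrow A\mid t:_iA\mid(\forall x)A\mid(\exists x)A$ with $i\in\mathcal{A}$ and $x$ a justification variable. Axioms (for every agent $i$): all propositional tautologies; Q1: $(\forall x)A(x)\rightarrow A(t)$, $t$ free for $x$; Q2: $(\forall x)(A\rightarrow B(x))\rightarrow(A\rightarrow(\forall x)B(x))$, $x$ not free in $A$; Q3: $A(t)\rightarrow(\exists x)A(x)$, $t$ free for $x$; Q4: $(\forall x)(A(x)\rightarrow B)\rightarrow((\exists x)A(x)\rightarrow B)$, $x$ not free in $B$; jK: $s':_i(A\rightarrow B)\rightarrow(t:_iA\rightarrow(s'\cdot t):_iB)$; jT: $t:_iA\rightarrow A$; j4: $t:_iA\rightarrow !t:_it:_iA$; Sum: $s':_iA\rightarrow(s'+t):_iA$, $s':_iA\rightarrow(t+s'):_iA$.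 Rules: Modus Ponens; Gen: from $A$ infer $(\forall x)A$; Axiom Necessitation: from an axiom instance $A$ infer $f(x_1,\dots,x_k):_iA$. For a set $\mathcal{F}$ of formulas $f(x_1,\dots,x_k):_iA$ with $A$ an axiom instance, $\mathsf{QLP}^-_{\mathcal{F}}$ is the logic in which Axiom Necessitation only produces members of $\mathcal{F}$. -}

module Defs where

open import Data.Nat using (ℕ; _≡ᵇ_)
open import Data.Fin using (Fin)
open import Data.Bool using (Bool; true; false; not; _∧_; _∨_; if_then_else_; T)
open import Data.Vec using (Vec; []; _∷_)
import Data.Vec as Vec
open import Data.Maybe using (Maybe; just; nothing; _>>=_)
open import Relation.Binary.PropositionalEquality using (_≡_)

-- A primitive function symbol of
-- arity k is a pair (k , name); arity 0 gives justification constants.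

JVar : Set
JVar = ℕ

PVar : Set
PVar = ℕ

data Term : Set where
  var  : JVar → Term
  prim : (k : ℕ) → (f : ℕ) → Vec JVar k → Term
  _·_  : Term → Term → Term
  _⊕_  : Term → Term → Term
  !_   : Term → Term

const : ℕ → Term
const c = prim 0 c []

infixr 4 _⇒_
infixr 6 _∧'_
infixr 5 _∨'_
data Formula (n : ℕ) : Set where
  atom  : PVar → Formula n
  ⊥'    : Formula n
  ¬'_   : Formula n → Formula n
  _∧'_  : Formula n → Formula n → Formula n
  _∨'_  : Formula n → Formula n → Formula n
  _⇒_   : Formula n → Formula n → Formula n
  _∶[_]_ : Term → Fin n → Formula n → Formula n
  ∀'    : JVar → Formula n → Formula n
  ∃'    : JVar → Formula n → Formula n

occV : ∀ {k} → JVar → Vec JVar k → Bool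
occV x []       = false
occV x (y ∷ ys) = (x ≡ᵇ y) ∨ occV x ys

occT : JVar → Term → Bool
occT x (var y)       = x ≡ᵇ y
occT x (prim k f xs) = occV x xs
occT x (s · t)       = occT x s ∨ occT x t
occT x (s ⊕ t)       = occT x s ∨ occT x t
occT x (! t)         = occT x t

freeIn : ∀ {n} → JVar → Formula n → Bool
freeIn x (atom p)     = false
freeIn x ⊥'           = false
freeIn x (¬' A)       = freeIn x A
freeIn x (A ∧' B)     = freeIn x A ∨ freeIn x B
freeIn x (A ∨' B)     = freeIn x A ∨ freeIn x B
freeIn x (A ⇒ B)      = freeIn x A ∨ freeIn x B
freeIn x (t ∶[ i ] A) = occT x t ∨ freeIn x A
freeIn x (∀' y A)     = not (x ≡ᵇ y) ∧ freeIn x A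
freeIn x (∃' y A)     = not (x ≡ᵇ y) ∧ freeIn x A

freeFor : ∀ {n} → JVar → Term → Formula n → Bool
freeFor x t (atom p)     = true
freeFor x t ⊥'           = true
freeFor x t (¬' A)       = freeFor x t A
freeFor x t (A ∧' B)     = freeFor x t A ∧ freeFor x t B
freeFor x t (A ∨' B)     = freeFor x t A ∧ freeFor x t B
freeFor x t (A ⇒ B)      = freeFor x t A ∧ freeFor x t B
freeFor x t (u ∶[ i ] A) = freeFor x t A
freeFor x t (∀' y A)     = not (freeIn x (∀' y A)) ∨ (not (occT y t) ∧ freeFor x t A)
freeFor x t (∃' y A)     = not (freeIn x (∃' y A)) ∨ (not (occT y t) ∧ freeFor x t A)

-- Primitive terms f(x₁,…,x_k) only take variables as arguments, so the
-- substitution is partial: it is undefined (nothing) when x occurs as an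
-- argument of a primitive term and t is not a variable (the result would
-- not be a term of the language).

renV : ∀ {k} → JVar → JVar → Vec JVar k → Vec JVar k
renV x z ys = Vec.map (λ y → if x ≡ᵇ y then z else y) ys

substT : JVar → Term → Term → Maybe Term
substT x t (var y) = just (if x ≡ᵇ y then t else var y)
substT x (var z) (prim k f xs) = just (prim k f (renV x z xs))
substT x t (prim k f xs) =
  if occV x xs then nothing else just (prim k f xs)
substT x t (u · v) = substT x t u >>= λ u' → substT x t v >>= λ v' → just (u' · v')
substT x t (u ⊕ v) = substT x t u >>= λ u' → substT x t v >>= λ v' → just (u' ⊕ v')
substT x t (! u)   = substT x t u >>= λ u' → just (! u')

subst : ∀ {n} → JVar → Term → Formula n → Maybe (Formula n)
subst x t (atom p) = just (atom p)
subst x t ⊥'       = just ⊥'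
subst x t (¬' A)   = subst x t A >>= λ A' → just (¬' A')
subst x t (A ∧' B) = subst x t A >>= λ A' → subst x t B >>= λ B' → just (A' ∧' B')
subst x t (A ∨' B) = subst x t A >>= λ A' → subst x t B >>= λ B' → just (A' ∨' B')
subst x t (A ⇒ B)  = subst x t A >>= λ A' → subst x t B >>= λ B' → just (A' ⇒ B')
subst x t (u ∶[ i ] A) =
  substT x t u >>= λ u' → subst x t A >>= λ A' → just (u' ∶[ i ] A')
subst x t (∀' y A) =
  if x ≡ᵇ y then just (∀' y A) else (subst x t A >>= λ A' → just (∀' y A'))
subst x t (∃' y A) =
  if x ≡ᵇ y then just (∃' y A) else (subst x t A >>= λ A' → just (∃' y A'))

evalB : ∀ {n} → (Formula n → Bool) → Formula n → Bool
evalB v (atom p)     = v (atom p)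
evalB v ⊥'           = false
evalB v (¬' A)       = not (evalB v A)
evalB v (A ∧' B)     = evalB v A ∧ evalB v B
evalB v (A ∨' B)     = evalB v A ∨ evalB v B
evalB v (A ⇒ B)      = not (evalB v A) ∨ evalB v B
evalB v (t ∶[ i ] A) = v (t ∶[ i ] A)
evalB v (∀' x A)     = v (∀' x A)
evalB v (∃' x A)     = v (∃' x A)

Tautology : ∀ {n} → Formula n → Set
Tautology A = ∀ v → T (evalB v A)

data Axiom {n : ℕ} : Formula n → Set where
  taut : ∀ {A} → Tautology A → Axiom A
  Q1   : ∀ x t A B → T (freeFor x t A) → subst x t A ≡ just B →
         Axiom (∀' x A ⇒ B)
  Q2   : ∀ x A B → T (not (freeIn x A)) →
         Axiom (∀' x (A ⇒ B) ⇒ (A ⇒ ∀' x B))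
  Q3   : ∀ x t A B → T (freeFor x t A) → subst x t A ≡ just B →
         Axiom (B ⇒ ∃' x A)
  Q4   : ∀ x A B → T (not (freeIn x B)) →
         Axiom (∀' x (A ⇒ B) ⇒ (∃' x A ⇒ B))
  jK   : ∀ i s t A B →
         Axiom (s ∶[ i ] (A ⇒ B) ⇒ (t ∶[ i ] A ⇒ (s · t) ∶[ i ] B))
  jT   : ∀ i t A → Axiom (t ∶[ i ] A ⇒ A)
  j4   : ∀ i t A → Axiom (t ∶[ i ] A ⇒ (! t) ∶[ i ] (t ∶[ i ] A))
  Sum₁ : ∀ i s t A → Axiom (s ∶[ i ] A ⇒ (s ⊕ t) ∶[ i ] A)
  Sum₂ : ∀ i s t A → Axiom (s ∶[ i ] A ⇒ (t ⊕ s) ∶[ i ] A)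

infix 2 _⊢_
data _⊢_ {n : ℕ} (𝓕 : Formula n → Set) : Formula n → Set where
  ax  : ∀ {A} → Axiom A → 𝓕 ⊢ A
  mp  : ∀ {A B} → 𝓕 ⊢ A → 𝓕 ⊢ (A ⇒ B) → 𝓕 ⊢ B
  gen : ∀ {A} x → 𝓕 ⊢ A → 𝓕 ⊢ ∀' x A
  an  : ∀ {A} k f (xs : Vec JVar k) i → Axiom A →
        𝓕 (prim k f xs ∶[ i ] A) → 𝓕 ⊢ (prim k f xs ∶[ i ] A)

module Submission where

-- Let D = E ∧ ¬(∃x) x:_s E.  The proof shows that any justification y of D
-- yields a contradiction: by the certified axiom c:_s(D → E) and jK, y:_s D
-- gives (c·y):_s E, hence (∃x) x:_s E by Q3; by factivity jT, y:_s D gives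
-- D and therefore ¬(∃x) x:_s E.  So y:_s D → ⊥ holds for arbitrary y, and
-- Gen with Q4 turns this into (∃y) y:_s D → ⊥, i.e. ¬(∃y) y:_s D.

open import Defs
open import Data.Nat using (ℕ; zero; suc; _≡ᵇ_)
open import Data.Fin using (Fin)
open import Data.Bool using (true; false; not; _∧_; _∨_; T)
open import Data.Unit using (tt)
open import Data.Maybe using (just)
open import Data.Vec using ([])
open import Relation.Binary.PropositionalEquality using (_≡_; refl)

-- Boolean equality of natural numbers is reflexive; needed to compute the
-- substitution of a term for the bound variable itself.
≡ᵇ-refl : ∀ x → (x ≡ᵇ x) ≡ true
≡ᵇ-refl zero    = refl
≡ᵇ-refl (suc x) = ≡ᵇ-refl x

∧-elimˡ-tautology : ∀ {n} (P Q : Formula n) → Tautology (P ∧' Q ⇒ P)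
∧-elimˡ-tautology P Q v = table (evalB v P) (evalB v Q)
  where
  table : ∀ a b → T (not (a ∧ b) ∨ a)
  table false _     = tt
  table true  false = tt
  table true  true  = tt

module _ {n : ℕ} {𝓕 : Formula n → Set} where

  syllogism : ∀ {P Q R} → 𝓕 ⊢ P ⇒ Q → 𝓕 ⊢ Q ⇒ R → 𝓕 ⊢ P ⇒ R
  syllogism {P} {Q} {R} P⇒Q Q⇒R =
    mp Q⇒R (mp P⇒Q (ax (taut λ v → table (evalB v P) (evalB v Q) (evalB v R))))
    where
    table : ∀ a b c → T (not (not a ∨ b) ∨ (not (not b ∨ c) ∨ (not a ∨ c)))
    table false false _     = tt
    table false true  false = tt
    table false true  true  = tt
    table true  false _     = tt
    table true  true  false = tt
    table true  true  true  = tt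

  refute : ∀ {P Q} → 𝓕 ⊢ P ⇒ Q → 𝓕 ⊢ P ⇒ ¬' Q → 𝓕 ⊢ P ⇒ ⊥'
  refute {P} {Q} P⇒Q P⇒¬Q =
    mp P⇒¬Q (mp P⇒Q (ax (taut λ v → table (evalB v P) (evalB v Q))))
    where
    table : ∀ a b → T (not (not a ∨ b) ∨ (not (not a ∨ not b) ∨ (not a ∨ false)))
    table false _     = tt
    table true  false = tt
    table true  true  = tt

  ¬-intro : ∀ {P} → 𝓕 ⊢ P ⇒ ⊥' → 𝓕 ⊢ ¬' P
  ¬-intro {P} P⇒⊥ = mp P⇒⊥ (ax (taut λ v → table (evalB v P)))
    where
    table : ∀ a → T (not (not a ∨ false) ∨ not a)
    table false = tt
    table true  = tt

  ∧-elimʳ : ∀ {P Q} → 𝓕 ⊢ P ∧' Q ⇒ Q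
  ∧-elimʳ {P} {Q} = ax (taut λ v → table (evalB v P) (evalB v Q))
    where
    table : ∀ a b → T (not (a ∧ b) ∨ b)
    table false _     = tt
    table true  false = tt
    table true  true  = tt

  ∃-elim : ∀ x {A B} → T (not (freeIn x B)) → 𝓕 ⊢ A ⇒ B → 𝓕 ⊢ ∃' x A ⇒ B
  ∃-elim x {A} {B} x∉B A⇒B = mp (gen x A⇒B) (ax (Q4 x A B x∉B))

  ∃-justification : ∀ i p x t → 𝓕 ⊢ t ∶[ i ] atom p ⇒ ∃' x (var x ∶[ i ] atom p)
  ∃-justification i p x t =
    ax (Q3 x t (var x ∶[ i ] atom p) (t ∶[ i ] atom p) tt substitution)
    where
    substitution : subst x t (var x ∶[ i ] atom p) ≡ just (t ∶[ i ] atom p)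
    substitution rewrite ≡ᵇ-refl x = refl

  apply : ∀ {i s A B} t → 𝓕 ⊢ s ∶[ i ] (A ⇒ B) → 𝓕 ⊢ t ∶[ i ] A ⇒ (s · t) ∶[ i ] B
  apply {i} {s} {A} {B} t s∶A⇒B = mp s∶A⇒B (ax (jK i s t A B))

theorem31 : (n : ℕ) (s : Fin n) (e c x y : ℕ) →
    (λ φ → φ ≡ (const c ∶[ s ] ((atom e ∧' ¬' ∃' x (var x ∶[ s ] atom e)) ⇒ atom e)))
      ⊢ ¬' ∃' y (var y ∶[ s ] (atom e ∧' ¬' ∃' x (var x ∶[ s ] atom e)))
theorem31 n s e c x y =
  ¬-intro (∃-elim y tt (refute y∶D⇒someJustifiesE y∶D⇒noneJustifiesE))
  where
  E D : Formula n
  E = atom e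
  D = E ∧' ¬' ∃' x (var x ∶[ s ] E)

  𝓕 : Formula n → Set
  𝓕 φ = φ ≡ (const c ∶[ s ] (D ⇒ E))

  c∶D⇒E : 𝓕 ⊢ const c ∶[ s ] (D ⇒ E)
  c∶D⇒E = an 0 c [] s (taut (∧-elimˡ-tautology E (¬' ∃' x (var x ∶[ s ] E)))) refl

  y∶D⇒someJustifiesE : 𝓕 ⊢ var y ∶[ s ] D ⇒ ∃' x (var x ∶[ s ] E)
  y∶D⇒someJustifiesE =
    syllogism (apply (var y) c∶D⇒E) (∃-justification s e x (const c · var y))

  y∶D⇒noneJustifiesE : 𝓕 ⊢ var y ∶[ s ] D ⇒ ¬' ∃' x (var x ∶[ s ] E)
  y∶D⇒noneJustifiesE = syllogism (ax (jT s (var y) D)) ∧-elimʳ
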